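{- Let $\mathcal{C}$ be a context schema, $F$ a formula, $\Gamma$ a context variable, and let $G$ and $G'$ be context expressions such that $G\succeq^\Gamma_F G'$ and $G\lhd_{\mathcal{C}}G'$ are derivable. For any substitution $\theta$, if $G'[\theta]$ is defined then so is $G[\theta]$; moreover, $G[\theta]\succeq^\Gamma_F G'[\theta]$ and $G[\theta]\lhd_{\mathcal{C}}G'[\theta]$ are derivable.
   Context: Canonical LF over a fixed well-formed signature $\Sigma$: types $A ::= P\mid\Pi x{:}A.B$, $P ::= a\mid P\,M$, terms $M ::= R\mid\lambda x.M$, $R ::= c\mid x\mid R\,M$. A substitution is a finite set $\theta=\{\langle x_i,M_i,\alpha_i\rangle\}$ (distinct variables, canonical terms, arity types); $E[\theta]$ is its hereditary application (capture-avoiding replacement followed by normalization guided by arity types), possibly undefined; it applies to a context expression by applying to the type of each binding (defined iff all of these are). Nominal constants $n$ may appear in types and terms like constants. Context expressions: $G ::= \Gamma\mid\cdot\mid G,n{:}A$; types in them may contain term variables. Block schemas $\{x_1{:}\alpha_1,\ldots,x_n{:}\alpha_n\}y_1{:}A_1,\ldots,y_m{:}A_m$; a context schema $\mathcal{C}$ is a finite list of block schemas. Formulas of $\mathcal{L}_{LF}$: $F ::= \{G\vdash M:A\}\mid\top\mid\bot\mid F_1\supset F_2\mid F_1\wedge F_2\mid F_1\vee F_2\mid\forall x{:}\alpha.F\mid\exists x{:}\alpha.F\mid\Pi\Gamma{:}\mathcal{C}.F$. Subordination. $\mathrm{head}(a\,M_1\cdots M_n)=a$, $\mathrm{head}(\Pi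 x{:}A.B)=\mathrm{head}(B)$. $\preceq$ is the least reflexive transitive relation on type constants of $\Sigma$ with $\mathrm{head}(A_i)\preceq a$ for each $a:\Pi x_1{:}A_1\ldots\Pi x_n{:}A_n.\mathrm{Type}$ and $\mathrm{head}(A_i)\preceq\mathrm{head}(A)$ for each $c:\Pi x_1{:}A_1\ldots\Pi x_n{:}A_n.A$ in $\Sigma$; on types $A\preceq B$ iff $\mathrm{head}(A)\preceq\mathrm{head}(B)$. Type subordinate to a formula: $A\preceq_\Gamma F$ is the least relation with: $A\preceq_\Gamma\Pi\Gamma'{:}\mathcal{C}.F$ if $\Gamma'\ne\Gamma$ and $A\preceq_\Gamma F$; $A\preceq_\Gamma\forall x{:}\alpha.F$, $A\preceq_\Gamma\exists x{:}\alpha.F$ if $A\preceq_\Gamma F$; $A\preceq_\Gamma F_1\bullet F_2$ ($\bullet\in\{\supset,\wedge,\vee\}$) if $A\preceq_\Gamma F_1$ or $A\preceq_\Gamma F_2$; $A\preceq_\Gamma\{\Gamma\vdash M:A'\}$ if $A\preceq A'$; $A\preceq_\Gamma\{\Gamma,n_1{:}A_1,\ldots,n_k{:}A_k\vdash M:A'\}$ for all $A$ when $k\ge1$. Subsumption: $G\succeq^\Gamma_F G'$ is the least relation with $\cdot\succeq^\Gamma_F\cdot$; $G,n{:}A\succeq^\Gamma_F G',n{:}A$ if $G\succeq^\Gamma_F G'$; $G\succeq^\Gamma_F G',n{:}A$ if $G\succeq^\Gamma_F G'$ and $A\preceq_\Gamma F$ fails. Pruning. $G\lhd_{\mathcal{C}}G'$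 is the least relation with $\cdot\lhd_{\mathcal{C}}\cdot$; $G,n{:}A\lhd_{\mathcal{C}}G',n{:}A$ if $G\lhd_{\mathcal{C}}G'$; $G\lhd_{\mathcal{C}}G',n{:}A$ if $G\lhd_{\mathcal{C}}G'$ and $A\not\preceq A'$ for every $A'$ such that a binding $y{:}A'$ appears in a block declaration of $\mathcal{C}$. -}

module Defs where

open import Data.Nat using (ℕ; zero; suc)
open import Data.Fin using (Fin; zero; suc; punchOut)
open import Data.Fin.Properties using () renaming (_≟_ to _≟ᶠ_)
open import Data.Nat.Properties using () renaming (_≟_ to _≟ⁿ_)
open import Data.List using (List; []; _∷_)
open import Data.List.Membership.Propositional using (_∈_)
open import Data.Maybe using (Maybe; just; nothing)
open import Data.Product using (_×_; _,_)
open import Relation.Nullary using (¬_; yes; no)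
open import Relation.Binary.PropositionalEquality using (_≡_; _≢_)

bindM : {A B : Set} → Maybe A → (A → Maybe B) → Maybe B
bindM (just a) f = f a
bindM nothing  f = nothing

mapM : {A B : Set} → (A → B) → Maybe A → Maybe B
mapM f (just a) = just (f a)
mapM f nothing  = nothing

infixr 5 _⇒_
data Arity : Set where
  o   : Arity
  _⇒_ : Arity → Arity → Arity

-- Canonical LF syntax (locally nameless).
-- Free term variables x: names (ℕ); constants c, nominal constants n,
-- type constants a: names (ℕ).
-- A root R ::= c | x | R M is represented as a head applied to a spine.

data Head (n : ℕ) : Set where
  con  : ℕ → Head n
  fvar : ℕ → Head n
  nom  : ℕ → Head n
  bvar : Fin n → Head n

data Tm (n : ℕ) : Set where
  lam  : Tm (suc n) → Tm n
  root : Head n → List (Tm n) → Tm n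

data Ty (n : ℕ) : Set where
  atom : ℕ → List (Tm n) → Ty n
  pi   : Ty n → Ty (suc n) → Ty n

data Kind (n : ℕ) : Set where
  type : Kind n
  pi   : Ty n → Kind (suc n) → Kind n

lift : {n m : ℕ} → (Fin n → Fin m) → Fin (suc n) → Fin (suc m)
lift ρ zero    = zero
lift ρ (suc i) = suc (ρ i)

renH : {n m : ℕ} → (Fin n → Fin m) → Head n → Head m
renH ρ (con c)  = con c
renH ρ (fvar x) = fvar x
renH ρ (nom a)  = nom a
renH ρ (bvar i) = bvar (ρ i)

mutual
  renTm : {n m : ℕ} → (Fin n → Fin m) → Tm n → Tm m
  renTm ρ (lam t)     = lam (renTm (lift ρ) t)
  renTm ρ (root h sp) = root (renH ρ h) (renSp ρ sp)

  renSp : {n m : ℕ} → (Fin n → Fin m) → List (Tm n) → List (Tm m)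
  renSp ρ []       = []
  renSp ρ (t ∷ ts) = renTm ρ t ∷ renSp ρ ts

weakenClosed : {n : ℕ} → Tm 0 → Tm n
weakenClosed = renTm (λ ())

-- Hereditary instantiation of a bound variable, guided by arity types.
-- inst α i N t : replace bound variable i of t by N (of arity α),
-- normalizing hereditarily; undefined (nothing) on arity mismatch.
-- reduce α M sp : hereditarily apply M (of arity α) to the spine sp.

mutual
  inst : Arity → {n : ℕ} → Fin (suc n) → Tm n → Tm (suc n) → Maybe (Tm n)
  inst α i N (lam t)            = mapM lam (inst α (suc i) (renTm suc N) t)
  inst α i N (root (con c) sp)  = mapM (root (con c)) (instSp α i N sp)
  inst α i N (root (fvar x) sp) = mapM (root (fvar x)) (instSp α i N sp)
  inst α i N (root (nom a) sp)  = mapM (root (nom a)) (instSp α i N sp)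
  inst α i N (root (bvar j) sp) = instVar α i N j (instSp α i N sp)

  instVar : Arity → {n : ℕ} → Fin (suc n) → Tm n → Fin (suc n)
          → Maybe (List (Tm n)) → Maybe (Tm n)
  instVar α i N j nothing = nothing
  instVar α i N j (just sp) with i ≟ᶠ j
  ... | yes _   = reduce α N sp
  ... | no i≢j = just (root (bvar (punchOut i≢j)) sp)

  instSp : Arity → {n : ℕ} → Fin (suc n) → Tm n → List (Tm (suc n))
         → Maybe (List (Tm n))
  instSp α i N []       = just []
  instSp α i N (t ∷ ts) =
    bindM (inst α i N t) (λ t' → mapM (t' ∷_) (instSp α i N ts))

  reduce : Arity → {n : ℕ} → Tm n → List (Tm n) → Maybe (Tm n)
  reduce α         M          []       = just M
  reduce o         M          (_ ∷ _)  = nothing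
  reduce (α₁ ⇒ α₂) (lam B)    (N ∷ Ns) =
    bindM (inst α₁ zero N B) (λ B' → reduce α₂ B' Ns)
  reduce (α₁ ⇒ α₂) (root _ _) (_ ∷ _)  = nothing

Subst : Set
Subst = List (ℕ × Tm 0 × Arity)

lookupS : Subst → ℕ → Maybe (Tm 0 × Arity)
lookupS []                 x = nothing
lookupS ((y , M , α) ∷ θ) x with x ≟ⁿ y
... | yes _ = just (M , α)
... | no  _ = lookupS θ x

substVar : {n : ℕ} → Subst → ℕ → List (Tm n) → Maybe (Tm n)
substVar θ x sp with lookupS θ x
... | just (M , α) = reduce α (weakenClosed M) sp
... | nothing      = just (root (fvar x) sp)

mutual
  substTm : {n : ℕ} → Subst → Tm n → Maybe (Tm n)
  substTm θ (lam t)            = mapM lam (substTm θ t)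
  substTm θ (root (con c) sp)  = mapM (root (con c)) (substSp θ sp)
  substTm θ (root (nom a) sp)  = mapM (root (nom a)) (substSp θ sp)
  substTm θ (root (bvar i) sp) = mapM (root (bvar i)) (substSp θ sp)
  substTm θ (root (fvar x) sp) = bindM (substSp θ sp) (substVar θ x)

  substSp : {n : ℕ} → Subst → List (Tm n) → Maybe (List (Tm n))
  substSp θ []       = just []
  substSp θ (t ∷ ts) = bindM (substTm θ t) (λ t' → mapM (t' ∷_) (substSp θ ts))

substTy : {n : ℕ} → Subst → Ty n → Maybe (Ty n)
substTy θ (atom a sp) = mapM (atom a) (substSp θ sp)
substTy θ (pi A B)    = bindM (substTy θ A) (λ A' → mapM (pi A') (substTy θ B))

infixl 5 _,_∶_
data CtxE : Set where
  cvar  : ℕ → CtxE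
  emp   : CtxE
  _,_∶_ : CtxE → ℕ → Ty 0 → CtxE

substCtx : Subst → CtxE → Maybe CtxE
substCtx θ (cvar Γ)    = just (cvar Γ)
substCtx θ emp         = just emp
substCtx θ (G , n ∶ A) =
  bindM (substCtx θ G) (λ G' → mapM (λ A' → G' , n ∶ A') (substTy θ A))

record BlockSchema : Set where
  constructor block
  field
    params : List (ℕ × Arity)
    decls  : List (ℕ × Ty 0)
open BlockSchema public

CtxSchema : Set
CtxSchema = List BlockSchema

data Form : Set where
  atm  : CtxE → Tm 0 → Ty 0 → Form
  top  : Form
  bot  : Form
  imp  : Form → Form → Form
  and  : Form → Form → Form
  or   : Form → Form → Form
  all  : ℕ → Arity → Form → Form
  ex   : ℕ → Arity → Form → Form
  ctxΠ : ℕ → CtxSchema → Form → Form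

data Decl : Set where
  tyc : ℕ → Kind 0 → Decl
  tmc : ℕ → Ty 0 → Decl

Signature : Set
Signature = List Decl

head : {n : ℕ} → Ty n → ℕ
head (atom a _) = a
head (pi A B)   = head B

data KArgHead : {n : ℕ} → Kind n → ℕ → Set where
  here  : {n : ℕ} {A : Ty n} {K : Kind (suc n)} → KArgHead (pi A K) (head A)
  there : {n : ℕ} {A : Ty n} {K : Kind (suc n)} {b : ℕ}
        → KArgHead K b → KArgHead (pi A K) b

data TArgHead : {n : ℕ} → Ty n → ℕ → Set where
  here  : {n : ℕ} {A : Ty n} {B : Ty (suc n)} → TArgHead (pi A B) (head A)
  there : {n : ℕ} {A : Ty n} {B : Ty (suc n)} {b : ℕ}
        → TArgHead B b → TArgHead (pi A B) b

data _⊢_≼_ (Sg : Signature) : ℕ → ℕ → Set where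
  ≼-refl  : {a : ℕ} → Sg ⊢ a ≼ a
  ≼-trans : {a b c : ℕ} → Sg ⊢ a ≼ b → Sg ⊢ b ≼ c → Sg ⊢ a ≼ c
  ≼-kind  : {a b : ℕ} {K : Kind 0} → tyc a K ∈ Sg → KArgHead K b → Sg ⊢ b ≼ a
  ≼-con   : {c b : ℕ} {T : Ty 0} → tmc c T ∈ Sg → TArgHead T b → Sg ⊢ b ≼ head T

_⊢_≼ᵀ_ : {n m : ℕ} → Signature → Ty n → Ty m → Set
Sg ⊢ A ≼ᵀ B = Sg ⊢ head A ≼ head B

data ExtOf (Γ : ℕ) : CtxE → Set where
  one  : {n : ℕ} {B : Ty 0} → ExtOf Γ (cvar Γ , n ∶ B)
  more : {G : CtxE} {n : ℕ} {B : Ty 0} → ExtOf Γ G → ExtOf Γ (G , n ∶ B)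

data SubF (Sg : Signature) (A : Ty 0) (Γ : ℕ) : Form → Set where
  s-ctx   : {Γ' : ℕ} {C : CtxSchema} {F : Form}
          → Γ' ≢ Γ → SubF Sg A Γ F → SubF Sg A Γ (ctxΠ Γ' C F)
  s-all   : {x : ℕ} {α : Arity} {F : Form} → SubF Sg A Γ F → SubF Sg A Γ (all x α F)
  s-ex    : {x : ℕ} {α : Arity} {F : Form} → SubF Sg A Γ F → SubF Sg A Γ (ex x α F)
  s-impL  : {F₁ F₂ : Form} → SubF Sg A Γ F₁ → SubF Sg A Γ (imp F₁ F₂)
  s-impR  : {F₁ F₂ : Form} → SubF Sg A Γ F₂ → SubF Sg A Γ (imp F₁ F₂)
  s-andL  : {F₁ F₂ : Form} → SubF Sg A Γ F₁ → SubF Sg A Γ (and F₁ F₂)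
  s-andR  : {F₁ F₂ : Form} → SubF Sg A Γ F₂ → SubF Sg A Γ (and F₁ F₂)
  s-orL   : {F₁ F₂ : Form} → SubF Sg A Γ F₁ → SubF Sg A Γ (or F₁ F₂)
  s-orR   : {F₁ F₂ : Form} → SubF Sg A Γ F₂ → SubF Sg A Γ (or F₁ F₂)
  s-atm   : {M : Tm 0} {A' : Ty 0} → Sg ⊢ A ≼ᵀ A' → SubF Sg A Γ (atm (cvar Γ) M A')
  s-atmExt : {G : CtxE} {M : Tm 0} {A' : Ty 0} → ExtOf Γ G → SubF Sg A Γ (atm G M A')

data Subsumes (Sg : Signature) (Γ : ℕ) (F : Form) : CtxE → CtxE → Set where
  sb-emp  : Subsumes Sg Γ F emp emp
  sb-keep : {G G' : CtxE} {n : ℕ} {A : Ty 0}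
          → Subsumes Sg Γ F G G' → Subsumes Sg Γ F (G , n ∶ A) (G' , n ∶ A)
  sb-drop : {G G' : CtxE} {n : ℕ} {A : Ty 0}
          → Subsumes Sg Γ F G G' → ¬ SubF Sg A Γ F → Subsumes Sg Γ F G (G' , n ∶ A)

data Prunes (Sg : Signature) (C : CtxSchema) : CtxE → CtxE → Set where
  pr-emp  : Prunes Sg C emp emp
  pr-keep : {G G' : CtxE} {n : ℕ} {A : Ty 0}
          → Prunes Sg C G G' → Prunes Sg C (G , n ∶ A) (G' , n ∶ A)
  pr-drop : {G G' : CtxE} {n : ℕ} {A : Ty 0}
          → Prunes Sg C G G'
          → ({b : BlockSchema} → b ∈ C → {y : ℕ} {A' : Ty 0}
               → (y , A') ∈ decls b → ¬ (Sg ⊢ A ≼ᵀ A'))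
          → Prunes Sg C G (G' , n ∶ A)

-- Applying θ to a context expression acts binding by binding and leaves the
-- head of every type unchanged (a substitution only rewrites the spines of
-- atomic types).  Whether a binding may be dropped, by subsumption as well as
-- by pruning, depends on its type only through that head, so every dropping
-- step of G ⪰ G' or G ◁ G' survives the substitution, and every kept binding
-- of G'[θ] is also a binding of G[θ].
module Submission where

open import Defs
open import Data.Nat using (ℕ)
open import Data.List using (map)
open import Data.List.Relation.Unary.Unique.Propositional using (Unique)
open import Data.Maybe using (just)
open import Data.Maybe.Properties using (just-injective)
open import Data.Product using (∃; ∃₂; _×_; proj₁; _,_)
open import Relation.Binary.PropositionalEquality using (_≡_; refl; sym; trans; subst)

substTy-head : {n : ℕ} (θ : Subst) (A : Ty n) {A' : Ty n}
  → substTy θ A ≡ just A' → head A' ≡ head A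
substTy-head θ (atom a sp) eq with substSp θ sp
substTy-head θ (atom a sp) refl | just _ = refl
substTy-head θ (pi A B) eq with substTy θ A | substTy θ B in eqB
substTy-head θ (pi A B) refl | just _ | just _ = substTy-head θ B eqB

SubF-resp-head : {Sg : Signature} {A B : Ty 0} {Γ : ℕ} {F : Form}
  → head A ≡ head B → SubF Sg A Γ F → SubF Sg B Γ F
SubF-resp-head h (s-ctx Γ'≢Γ p) = s-ctx Γ'≢Γ (SubF-resp-head h p)
SubF-resp-head h (s-all p)      = s-all (SubF-resp-head h p)
SubF-resp-head h (s-ex p)       = s-ex (SubF-resp-head h p)
SubF-resp-head h (s-impL p)     = s-impL (SubF-resp-head h p)
SubF-resp-head h (s-impR p)     = s-impR (SubF-resp-head h p)
SubF-resp-head h (s-andL p)     = s-andL (SubF-resp-head h p)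
SubF-resp-head h (s-andR p)     = s-andR (SubF-resp-head h p)
SubF-resp-head h (s-orL p)      = s-orL (SubF-resp-head h p)
SubF-resp-head h (s-orR p)      = s-orR (SubF-resp-head h p)
SubF-resp-head h (s-atm A≼A')   = s-atm (subst (λ a → _ ⊢ a ≼ _) h A≼A')
SubF-resp-head h (s-atmExt ext) = s-atmExt ext

substCtx-,-inv : (θ : Subst) (G : CtxE) (n : ℕ) (A : Ty 0) {H : CtxE}
  → substCtx θ (G , n ∶ A) ≡ just H
  → ∃₂ λ G₁ A₁ → substCtx θ G ≡ just G₁ × substTy θ A ≡ just A₁ × H ≡ (G₁ , n ∶ A₁)
substCtx-,-inv θ G n A eq with substCtx θ G | substTy θ A
substCtx-,-inv θ G n A refl | just G₁ | just A₁ = G₁ , A₁ , refl , refl , refl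

substCtx-, : (θ : Subst) (G : CtxE) (n : ℕ) (A : Ty 0) {G₁ : CtxE} {A₁ : Ty 0}
  → substCtx θ G ≡ just G₁ → substTy θ A ≡ just A₁
  → substCtx θ (G , n ∶ A) ≡ just (G₁ , n ∶ A₁)
substCtx-, θ G n A eqG eqA rewrite eqG | eqA = refl

Subsumes-substCtx : {Sg : Signature} {Γ : ℕ} {F : Form} (θ : Subst) {G G' H' : CtxE}
  → Subsumes Sg Γ F G G' → substCtx θ G' ≡ just H'
  → ∃ λ H → substCtx θ G ≡ just H × Subsumes Sg Γ F H H'
Subsumes-substCtx θ sb-emp refl = emp , refl , sb-emp
Subsumes-substCtx θ {G , n ∶ A} {G' , .n ∶ .A} (sb-keep G⪰G') eq
  with substCtx-,-inv θ G' n A eq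
... | G₁ , A₁ , eqG' , eqA , refl with Subsumes-substCtx θ G⪰G' eqG'
... | H , eqG , H⪰G₁ = (H , n ∶ A₁) , substCtx-, θ G n A eqG eqA , sb-keep H⪰G₁
Subsumes-substCtx θ {G} {G' , n ∶ A} (sb-drop G⪰G' A⋠F) eq
  with substCtx-,-inv θ G' n A eq
... | G₁ , A₁ , eqG' , eqA , refl with Subsumes-substCtx θ G⪰G' eqG'
... | H , eqG , H⪰G₁ =
  H , eqG , sb-drop H⪰G₁ (λ A₁≼F → A⋠F (SubF-resp-head (substTy-head θ A eqA) A₁≼F))

Prunes-substCtx : {Sg : Signature} {C : CtxSchema} (θ : Subst) {G G' H' : CtxE}
  → Prunes Sg C G G' → substCtx θ G' ≡ just H'
  → ∃ λ H → substCtx θ G ≡ just H × Prunes Sg C H H'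
Prunes-substCtx θ pr-emp refl = emp , refl , pr-emp
Prunes-substCtx θ {G , n ∶ A} {G' , .n ∶ .A} (pr-keep G◁G') eq
  with substCtx-,-inv θ G' n A eq
... | G₁ , A₁ , eqG' , eqA , refl with Prunes-substCtx θ G◁G' eqG'
... | H , eqG , H◁G₁ = (H , n ∶ A₁) , substCtx-, θ G n A eqG eqA , pr-keep H◁G₁
Prunes-substCtx {Sg} θ {G} {G' , n ∶ A} (pr-drop G◁G' A⋠C) eq
  with substCtx-,-inv θ G' n A eq
... | G₁ , A₁ , eqG' , eqA , refl with Prunes-substCtx θ G◁G' eqG'
... | H , eqG , H◁G₁ =
  H , eqG , pr-drop H◁G₁ (λ b∈C y∈b A₁≼A' →
    A⋠C b∈C y∈b (subst (λ a → Sg ⊢ a ≼ _) (substTy-head θ A eqA) A₁≼A'))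

lemma4p11 : (Sg : Signature) (C : CtxSchema) (F : Form) (Γ : ℕ) (G G' : CtxE)
    → Subsumes Sg Γ F G G' → Prunes Sg C G G'
    → (θ : Subst) → Unique (map proj₁ θ)
    → (H' : CtxE) → substCtx θ G' ≡ just H'
    → ∃ λ H → substCtx θ G ≡ just H × Subsumes Sg Γ F H H' × Prunes Sg C H H'
lemma4p11 Sg C F Γ G G' G⪰G' G◁G' θ _ H' eq
  with Subsumes-substCtx θ G⪰G' eq | Prunes-substCtx θ G◁G' eq
... | H , eqG , H⪰H' | H₂ , eqG₂ , H₂◁H' with just-injective (trans (sym eqG) eqG₂)
... | refl = H , eqG , H⪰H' , H₂◁H'
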